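{- The series $\mathcal{VO}(z,q)$ and $\mathcal{XO}(z,q)$ belong to $\mathscr{U}_{z,q}^2$. In particular, $VO(m,n)\ge VO(m+2,n)$ and $XO(m,n)\ge XO(m+2,n)$ for all integers $m,n\ge0$.
   Context: $(a;q)_n=\prod_{0\le j<n}(1-aq^j)$ for $n\in\mathbb{N}_0\cup\{\infty\}$, $(a,b;q)_n=(a;q)_n(b;q)_n$. Define $$\mathcal{VO}(z,q)=\sum_{n\ge0}\sum_mVO(m,n)z^mq^n=\sum_{n\ge1}\frac{q^{2n-1}}{(zq^{2n+1},z^{ -1}q^{2n+1};q^2)_\infty},\quad \mathcal{XO}(z,q)=\sum_{n\ge0}\sum_mXO(m,n)z^mq^n=\sum_{n\ge0}\frac{q^{2n+1}}{(zq,z^{ -1}q;q^2)_n}$$ (rank generating functions of odd concave and odd convex compositions). $\mathscr{U}_z^2$ is the set of Laurent polynomials $\sum_ic_iz^i$ with real $c_i\ge0$, $c_{ -i}=c_i$ and $c_{r+2\ell}\ge c_{r+2(\ell+1)}$ for $r\in\{0,1\}$, $\ell\ge0$; a series $\sum_nC_n(z)q^n$ lies in $\mathscr{U}_{z,q}^2$ if every $C_n(z)\in\mathscr{U}_z^2$. -}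

module Defs where

open import Data.Bool using (Bool; true; false; if_then_else_)
open import Data.Nat as ℕ using (ℕ; zero; suc; _∸_; _%_; _/_; _≡ᵇ_)
open import Data.Integer as ℤ using (ℤ; +_; -_)
open import Data.List using (List; []; _∷_; [_]; _++_; map; concatMap; foldr; upTo)
open import Data.Product using (_×_; _,_)
open import Relation.Nullary.Decidable using (⌊_⌋)
open import Relation.Binary.PropositionalEquality using (_≡_)

-- Laurent polynomials in z with integer coefficients, represented as a
-- (not necessarily normalised) finite list of terms (exponent , coefficient).

LP : Set
LP = List (ℤ × ℤ)

coeffLP : LP → ℤ → ℤ
coeffLP [] m = + 0
coeffLP ((e , c) ∷ t) m =
  if ⌊ e ℤ.≟ m ⌋ then c ℤ.+ coeffLP t m else coeffLP t m

mulLP : LP → LP → LP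
mulLP p r = concatMap (λ { (e , c) → map (λ { (e' , c') → (e ℤ.+ e' , c ℤ.* c') }) r }) p

-- Formal power series in q with Laurent-polynomial coefficients:
-- f N is the coefficient of q^N.

PS : Set
PS = ℕ → LP

_⊕_ : PS → PS → PS
(f ⊕ g) N = f N ++ g N

_⊗_ : PS → PS → PS
(f ⊗ g) N = concatMap (λ i → mulLP (f i) (g (N ∸ i))) (upTo (suc N))

zeroPS : PS
zeroPS _ = []

onePS : PS
onePS zero = [ (+ 0 , + 1) ]
onePS (suc _) = []

qpow : ℕ → PS
qpow k N = if k ≡ᵇ N then [ (+ 0 , + 1) ] else []

-- geom e j = 1 / (1 - z^e q^(j+1)) = Σ_t z^(e t) q^((j+1) t)
geom : ℤ → ℕ → PS
geom e j N =
  if (N % suc j) ≡ᵇ 0 then [ (e ℤ.* (+ (N / suc j)) , + 1) ] else []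

prodPS : List PS → PS
prodPS = foldr _⊗_ onePS

sumPS : List PS → PS
sumPS = foldr _⊕_ zeroPS

-- invPoch e b n = 1 / (z^e q^(b+1) ; q^2)_n = ∏_{0≤j<n} 1/(1 - z^e q^(b+1+2j))
invPoch : ℤ → ℕ → ℕ → PS
invPoch e b n = prodPS (map (λ j → geom e (b ℕ.+ 2 ℕ.* j)) (upTo n))

-- invPochInf e b = 1 / (z^e q^(b+1) ; q^2)_∞, as a formal infinite product:
-- the factor with index j is ≡ 1 mod q^(j+1), so the q^N coefficient of the
-- infinite product equals that of the finite product over j ≤ N.
invPochInf : ℤ → ℕ → PS
invPochInf e b N = invPoch e b (suc N) N

-- VO(z,q) = Σ_{n≥1} q^(2n-1) / (z q^(2n+1), z^{-1} q^(2n+1); q^2)_∞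
-- (with n = k+1; the k-th term is O(q^(2k+1)), so for the q^N coefficient
-- only k ≤ N contribute).
VOser : PS
VOser N =
  sumPS (map (λ k → qpow (2 ℕ.* k ℕ.+ 1)
                  ⊗ (invPochInf (+ 1) (2 ℕ.* k ℕ.+ 2)
                  ⊗ invPochInf (- (+ 1)) (2 ℕ.* k ℕ.+ 2)))
             (upTo (suc N))) N

-- XO(z,q) = Σ_{n≥0} q^(2n+1) / (z q, z^{-1} q; q^2)_n
-- (the n-th term is O(q^(2n+1)), so only n ≤ N contribute to q^N).
XOser : PS
XOser N =
  sumPS (map (λ n → qpow (2 ℕ.* n ℕ.+ 1)
                  ⊗ (invPoch (+ 1) 0 n ⊗ invPoch (- (+ 1)) 0 n))
             (upTo (suc N))) N

VO : ℤ → ℕ → ℤ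
VO m n = coeffLP (VOser n) m

XO : ℤ → ℕ → ℤ
XO m n = coeffLP (XOser n) m

InU2z : (ℤ → ℤ) → Set
InU2z c =
  (∀ i → + 0 ℤ.≤ c i)
  × (∀ i → c (- i) ≡ c i)
  × (∀ r ℓ → r ℕ.≤ 1 → c (+ (r ℕ.+ 2 ℕ.* (suc ℓ))) ℤ.≤ c (+ (r ℕ.+ 2 ℕ.* ℓ)))

InU2zq : PS → Set
InU2zq f = ∀ n → InU2z (coeffLP (f n))

{-# OPTIONS --safe #-}
-- Both series are sums of q^(2n+1) times products of paired factors
--   1 / ((1 - z q^k) (1 - z⁻¹ q^k)) = ∑_t (z^t + z^(t-2) + ⋯ + z^(-t)) q^(k t),
-- so every q-coefficient is built from the coefficient 1 of the constant series by sums and by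
-- multiplications with z^t + z^(t-2) + ⋯ + z^(-t). Both operations preserve 𝒰²_z; for the second,
-- (z^(t+1) + ⋯ + z^(-t-1)) · G = z^(t+1) G + z⁻¹ (z^t + ⋯ + z^(-t)) G, and induction on t compares
-- the coefficients at n + 2 and n termwise, the case n = 0 coming from symmetry. Each coefficient of
-- an infinite product only involves finitely many of its factors.

module Submission where

open import Defs
open import Data.Nat using (ℕ)
open import Data.Integer using (+_; _≤_)
open import Data.Product using (_×_)

open import Algebra.Bundles using (CommutativeSemigroup)
import Algebra.Properties.CommutativeSemigroup as CommSemigroupProperties
open import Data.Bool using (true; false; if_then_else_)
open import Data.Nat as ℕ using (zero; suc; _∸_; _%_; _/_; _≡ᵇ_)
import Data.Nat.Properties as ℕₚ
open import Data.Nat.DivMod using (m≡m%n+[m/n]*n; [m+kn]%n≡m%n; %-distribˡ-+; m*n%n≡0; m*n/n≡m; m≤n⇒m%n≡m)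
open import Data.Integer as ℤ using (ℤ; 0ℤ; 1ℤ; _+_; _*_; _-_; -_)
import Data.Integer.Properties as ℤₚ
open import Data.Integer.Tactic.RingSolver using (solve-∀)
open import Data.List using ([]; _∷_; [_]; _++_; map; foldr; concatMap; upTo; applyUpTo)
open import Data.List.Properties using (map-++; foldr-++; upTo-∷ʳ; ++-identityʳ)
open import Data.Product using (_,_)
open import Function using (_∘_)
open import Level using (0ℓ)
open import Relation.Nullary using (contradiction)
open import Relation.Nullary.Decidable using (⌊_⌋; yes; no)
open import Relation.Binary.PropositionalEquality hiding ([_])
open ≡-Reasoning

open CommSemigroupProperties ℤₚ.+-commutativeSemigroup using () renaming (interchange to +-interchange)

∑< : ℕ → (ℕ → ℤ) → ℤ
∑< zero    f = 0ℤ
∑< (suc n) f = ∑< n f + f n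

syntax ∑< n (λ i → e) = ∑[ i < n ] e

∑-cong : ∀ n {f g : ℕ → ℤ} → (∀ i → i ℕ.< n → f i ≡ g i) → ∑< n f ≡ ∑< n g
∑-cong zero    eq = refl
∑-cong (suc n) eq = cong₂ _+_ (∑-cong n (λ i i<n → eq i (ℕₚ.m<n⇒m<1+n i<n))) (eq n ℕₚ.≤-refl)

∑-zero : ∀ n {f : ℕ → ℤ} → (∀ i → i ℕ.< n → f i ≡ 0ℤ) → ∑< n f ≡ 0ℤ
∑-zero zero    eq = refl
∑-zero (suc n) eq = cong₂ _+_ (∑-zero n (λ i i<n → eq i (ℕₚ.m<n⇒m<1+n i<n))) (eq n ℕₚ.≤-refl)

∑-+ : ∀ n (f g : ℕ → ℤ) → ∑[ i < n ] (f i + g i) ≡ ∑< n f + ∑< n g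
∑-+ zero    f g = refl
∑-+ (suc n) f g = trans (cong (_+ (f n + g n)) (∑-+ n f g)) (+-interchange (∑< n f) (∑< n g) (f n) (g n))

∑-head : ∀ n (f : ℕ → ℤ) → ∑< (suc n) f ≡ f 0 + ∑[ i < n ] f (suc i)
∑-head zero    f = trans (ℤₚ.+-identityˡ (f 0)) (sym (ℤₚ.+-identityʳ (f 0)))
∑-head (suc n) f = trans (cong (_+ f (suc n)) (∑-head n f)) (ℤₚ.+-assoc (f 0) _ _)

∑-++ : ∀ m n (f : ℕ → ℤ) → ∑< (m ℕ.+ n) f ≡ ∑< m f + ∑[ i < n ] f (m ℕ.+ i)
∑-++ m zero    f = trans (cong (λ k → ∑< k f) (ℕₚ.+-identityʳ m)) (sym (ℤₚ.+-identityʳ _))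
∑-++ m (suc n) f = begin
  ∑< (m ℕ.+ suc n) f                                  ≡⟨ cong (λ k → ∑< k f) (ℕₚ.+-suc m n) ⟩
  ∑< (m ℕ.+ n) f + f (m ℕ.+ n)                         ≡⟨ cong (_+ f (m ℕ.+ n)) (∑-++ m n f) ⟩
  ∑< m f + ∑[ i < n ] f (m ℕ.+ i) + f (m ℕ.+ n)        ≡⟨ ℤₚ.+-assoc (∑< m f) _ _ ⟩
  ∑< m f + ∑[ i < suc n ] f (m ℕ.+ i)                  ∎

∑-reverse : ∀ n (f : ℕ → ℤ) → ∑< n f ≡ ∑[ i < n ] f (n ∸ suc i)
∑-reverse zero    f = refl
∑-reverse (suc n) f = begin
  ∑< n f + f n                              ≡⟨ cong (_+ f n) (∑-reverse n f) ⟩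
  ∑[ i < n ] f (n ∸ suc i) + f n            ≡⟨ ℤₚ.+-comm _ (f n) ⟩
  f n + ∑[ i < n ] f (n ∸ suc i)            ≡⟨ ∑-head n (λ i → f (suc n ∸ suc i)) ⟨
  ∑[ i < suc n ] f (suc n ∸ suc i)          ∎

∑-nonneg : ∀ n {f : ℕ → ℤ} → (∀ i → 0ℤ ≤ f i) → 0ℤ ≤ ∑< n f
∑-nonneg zero    f≥0 = ℤₚ.≤-refl
∑-nonneg (suc n) f≥0 = ℤₚ.+-mono-≤ (∑-nonneg n f≥0) (f≥0 n)

conv : ℕ → (ℕ → ℕ → ℤ) → ℤ
conv N h = ∑[ i < suc N ] h i (N ∸ i)

conv-cong : ∀ N {h k : ℕ → ℕ → ℤ} → (∀ i j → i ℕ.+ j ≡ N → h i j ≡ k i j) → conv N h ≡ conv N k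
conv-cong N eq = ∑-cong (suc N) (λ i i≤N → eq i (N ∸ i) (ℕₚ.m+[n∸m]≡n (ℕₚ.≤-pred i≤N)))

conv-+ : ∀ N (h k : ℕ → ℕ → ℤ) → conv N (λ i j → h i j + k i j) ≡ conv N h + conv N k
conv-+ N h k = ∑-+ (suc N) (λ i → h i (N ∸ i)) (λ i → k i (N ∸ i))

conv-head : ∀ N (h : ℕ → ℕ → ℤ) → conv (suc N) h ≡ h 0 (suc N) + conv N (λ i j → h (suc i) j)
conv-head N h = ∑-head (suc N) (λ i → h i (suc N ∸ i))

conv-comm : ∀ N (h : ℕ → ℕ → ℤ) → conv N h ≡ conv N (λ i j → h j i)
conv-comm N h = trans (∑-reverse (suc N) (λ i → h i (N ∸ i)))
  (∑-cong (suc N) (λ i i≤N → cong (h (N ∸ i)) (ℕₚ.m∸[m∸n]≡n (ℕₚ.≤-pred i≤N))))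

conv-unitˡ : ∀ N (h : ℕ → ℕ → ℤ) → (∀ i j → h (suc i) j ≡ 0ℤ) → conv N h ≡ h 0 N
conv-unitˡ zero    h h≡0 = ℤₚ.+-identityˡ (h 0 0)
conv-unitˡ (suc N) h h≡0 = begin
  conv (suc N) h                               ≡⟨ conv-head N h ⟩
  h 0 (suc N) + conv N (λ i j → h (suc i) j)   ≡⟨ cong (_+_ (h 0 (suc N))) (∑-zero (suc N) (λ i _ → h≡0 i (N ∸ i))) ⟩
  h 0 (suc N) + 0ℤ                             ≡⟨ ℤₚ.+-identityʳ _ ⟩
  h 0 (suc N)                                  ∎

conv-assoc : ∀ N (H : ℕ → ℕ → ℕ → ℤ) →
  conv N (λ i j → conv i (λ k l → H k l j)) ≡ conv N (λ k p → conv p (λ l j → H k l j))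
conv-assoc zero    H = refl
conv-assoc (suc N) H = begin
  conv (suc N) (λ i j → conv i (λ k l → H k l j))
    ≡⟨ conv-head N (λ i j → conv i (λ k l → H k l j)) ⟩
  (0ℤ + H 0 0 (suc N)) + conv N (λ i j → conv (suc i) (λ k l → H k l j))
    ≡⟨ cong₂ _+_ (ℤₚ.+-identityˡ (H 0 0 (suc N))) (trans (conv-cong N (λ i j _ → conv-head i (λ k l → H k l j)))
                                                          (conv-+ N (λ i j → H 0 (suc i) j) (λ i j → conv i (λ k l → H (suc k) l j)))) ⟩
  H 0 0 (suc N) + (conv N (λ i j → H 0 (suc i) j) + conv N (λ i j → conv i (λ k l → H (suc k) l j)))
    ≡⟨ ℤₚ.+-assoc (H 0 0 (suc N)) _ _ ⟨
  (H 0 0 (suc N) + conv N (λ i j → H 0 (suc i) j)) + conv N (λ i j → conv i (λ k l → H (suc k) l j))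
    ≡⟨ cong₂ _+_ (sym (conv-head N (H 0))) (conv-assoc N (H ∘ suc)) ⟩
  conv (suc N) (H 0) + conv N (λ k p → conv p (λ l j → H (suc k) l j))
    ≡⟨ conv-head N (λ k p → conv p (λ l j → H k l j)) ⟨
  conv (suc N) (λ k p → conv p (λ l j → H k l j))
    ∎

-- dilate d f lists the coefficients of f(q^(d+1)) when f lists those of f(q).
dilate : ℕ → (ℕ → ℤ) → ℕ → ℤ
dilate d f i = if i % suc d ≡ᵇ 0 then f (i / suc d) else 0ℤ

dilate-cong : ∀ d {f g : ℕ → ℤ} → (∀ t → f t ≡ g t) → ∀ i → dilate d f i ≡ dilate d g i
dilate-cong d f≡g i = cong (if i % suc d ≡ᵇ 0 then_else 0ℤ) (f≡g (i / suc d))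

dilate-multiple : ∀ d (f : ℕ → ℤ) a → dilate d f (a ℕ.* suc d) ≡ f a
dilate-multiple d f a rewrite m*n%n≡0 a (suc d) ⦃ _ ⦄ | m*n/n≡m a (suc d) ⦃ _ ⦄ = refl

∑-multiples : ∀ d t (H : ℕ → ℤ) →
  ∑[ i < t ℕ.* suc d ] (if i % suc d ≡ᵇ 0 then H i else 0ℤ) ≡ ∑[ a < t ] H (a ℕ.* suc d)
∑-multiples d zero    H = refl
∑-multiples d (suc t) H = begin
  ∑< (suc d ℕ.+ t ℕ.* suc d) f
    ≡⟨ cong (λ n → ∑< n f) (ℕₚ.+-comm (suc d) (t ℕ.* suc d)) ⟩
  ∑< (t ℕ.* suc d ℕ.+ suc d) f
    ≡⟨ ∑-++ (t ℕ.* suc d) (suc d) f ⟩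
  ∑< (t ℕ.* suc d) f + ∑[ r < suc d ] f (t ℕ.* suc d ℕ.+ r)
    ≡⟨ cong₂ _+_ (∑-multiples d t H) (∑-head d (λ r → f (t ℕ.* suc d ℕ.+ r))) ⟩
  ∑[ a < t ] H (a ℕ.* suc d) + (f (t ℕ.* suc d ℕ.+ 0) + ∑[ r < d ] f (t ℕ.* suc d ℕ.+ suc r))
    ≡⟨ cong (_+_ (∑[ a < t ] H (a ℕ.* suc d))) (cong₂ _+_ multiple (∑-zero d non-multiple)) ⟩
  ∑[ a < t ] H (a ℕ.* suc d) + (H (t ℕ.* suc d) + 0ℤ)
    ≡⟨ cong (_+_ (∑[ a < t ] H (a ℕ.* suc d))) (ℤₚ.+-identityʳ _) ⟩
  ∑[ a < suc t ] H (a ℕ.* suc d)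
    ∎
  where
  f : ℕ → ℤ
  f i = if i % suc d ≡ᵇ 0 then H i else 0ℤ
  multiple : f (t ℕ.* suc d ℕ.+ 0) ≡ H (t ℕ.* suc d)
  multiple rewrite ℕₚ.+-identityʳ (t ℕ.* suc d) | m*n%n≡0 t (suc d) ⦃ _ ⦄ = refl
  non-multiple : ∀ r → r ℕ.< d → f (t ℕ.* suc d ℕ.+ suc r) ≡ 0ℤ
  non-multiple r r<d
    rewrite ℕₚ.+-comm (t ℕ.* suc d) (suc r) | [m+kn]%n≡m%n (suc r) t (suc d) ⦃ _ ⦄ | m≤n⇒m%n≡m r<d = refl

conv-dilate-multiple : ∀ d t (X : ℕ → ℕ → ℤ) →
  conv (t ℕ.* suc d) (λ i l → dilate d (λ a → dilate d (X a) l) i) ≡ conv t X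
conv-dilate-multiple d t X = cong₂ _+_
  (trans (∑-multiples d t (λ i → dilate d (X (i / suc d)) (t ℕ.* suc d ∸ i))) (∑-cong t (λ a _ → inner a)))
  last
  where
  inner : ∀ a → dilate d (X (a ℕ.* suc d / suc d)) (t ℕ.* suc d ∸ a ℕ.* suc d) ≡ X a (t ∸ a)
  inner a rewrite sym (ℕₚ.*-distribʳ-∸ (suc d) t a) | m*n/n≡m a (suc d) ⦃ _ ⦄ = dilate-multiple d (X a) (t ∸ a)
  last : dilate d (λ a → dilate d (X a) (t ℕ.* suc d ∸ t ℕ.* suc d)) (t ℕ.* suc d) ≡ X t (t ∸ t)
  last rewrite ℕₚ.n∸n≡0 (t ℕ.* suc d) | ℕₚ.n∸n≡0 t =
    trans (dilate-multiple d (λ a → dilate d (X a) 0) t) (dilate-multiple d (X t) 0)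

conv-dilate : ∀ d k (X : ℕ → ℕ → ℤ) →
  conv k (λ i l → dilate d (λ a → dilate d (X a) l) i) ≡ dilate d (λ t → conv t X) k
conv-dilate d k X = by-remainder (k % suc d) refl
  where
  by-remainder : ∀ r → k % suc d ≡ r →
    conv k (λ i l → dilate d (λ a → dilate d (X a) l) i) ≡ dilate d (λ t → conv t X) k
  by-remainder zero    k%d≡0 = begin
    conv k (λ i l → dilate d (λ a → dilate d (X a) l) i)
      ≡⟨ cong (λ n → conv n (λ i l → dilate d (λ a → dilate d (X a) l) i)) k≡ ⟩
    conv (k / suc d ℕ.* suc d) (λ i l → dilate d (λ a → dilate d (X a) l) i)
      ≡⟨ conv-dilate-multiple d (k / suc d) X ⟩
    conv (k / suc d) X
      ≡⟨ cong (λ r → if r ≡ᵇ 0 then conv (k / suc d) X else 0ℤ) k%d≡0 ⟨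
    dilate d (λ t → conv t X) k
      ∎
    where
    k≡ : k ≡ k / suc d ℕ.* suc d
    k≡ = trans (m≡m%n+[m/n]*n k (suc d)) (cong (ℕ._+ k / suc d ℕ.* suc d) k%d≡0)
  by-remainder (suc r) k%d≡ = trans (∑-zero (suc k) (λ i i≤k → vanishes i (ℕₚ.≤-pred i≤k)))
    (sym (cong (λ r → if r ≡ᵇ 0 then conv (k / suc d) X else 0ℤ) k%d≡))
    where
    vanishes : ∀ i → i ℕ.≤ k → dilate d (λ a → dilate d (X a) (k ∸ i)) i ≡ 0ℤ
    vanishes i i≤k with i % suc d in i%d≡ | (k ∸ i) % suc d in j%d≡
    ... | zero  | zero  = contradiction (begin
      suc r                                        ≡⟨ k%d≡ ⟨
      k % suc d                                    ≡⟨ cong (_% suc d) (ℕₚ.m+[n∸m]≡n i≤k) ⟨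
      (i ℕ.+ (k ∸ i)) % suc d                      ≡⟨ %-distribˡ-+ i (k ∸ i) (suc d) ⟩
      (i % suc d ℕ.+ (k ∸ i) % suc d) % suc d      ≡⟨ cong₂ (λ a b → (a ℕ.+ b) % suc d) i%d≡ j%d≡ ⟩
      0                                            ∎) ℕₚ.1+n≢0
    ... | zero  | suc _ = refl
    ... | suc _ | _     = refl

-- Laurent polynomials acting on coefficient functions

-- (p ⊛ g) m is the coefficient of z^m in p · G, where g m is the coefficient of z^m in G.
infixr 7 _⊛_
_⊛_ : LP → (ℤ → ℤ) → ℤ → ℤ
([]            ⊛ g) m = 0ℤ
(((e , c) ∷ p) ⊛ g) m = c * g (m - e) + (p ⊛ g) m

⊛-congʳ : ∀ p {g h : ℤ → ℤ} → g ≗ h → p ⊛ g ≗ p ⊛ h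
⊛-congʳ []            g≗h m = refl
⊛-congʳ ((e , c) ∷ p) g≗h m = cong₂ _+_ (cong (c *_) (g≗h (m - e))) (⊛-congʳ p g≗h m)

⊛-zeroʳ : ∀ p → p ⊛ (λ _ → 0ℤ) ≗ λ _ → 0ℤ
⊛-zeroʳ []            m = refl
⊛-zeroʳ ((e , c) ∷ p) m = cong₂ _+_ (ℤₚ.*-zeroʳ c) (⊛-zeroʳ p m)

⊛-distribʳ-+ : ∀ p (g h : ℤ → ℤ) → p ⊛ (λ x → g x + h x) ≗ λ m → (p ⊛ g) m + (p ⊛ h) m
⊛-distribʳ-+ []            g h m = refl
⊛-distribʳ-+ ((e , c) ∷ p) g h m = begin
  c * (g (m - e) + h (m - e)) + (p ⊛ (λ x → g x + h x)) m
    ≡⟨ cong₂ _+_ (ℤₚ.*-distribˡ-+ c (g (m - e)) (h (m - e))) (⊛-distribʳ-+ p g h m) ⟩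
  (c * g (m - e) + c * h (m - e)) + ((p ⊛ g) m + (p ⊛ h) m)
    ≡⟨ +-interchange (c * g (m - e)) _ _ _ ⟩
  (c * g (m - e) + (p ⊛ g) m) + (c * h (m - e) + (p ⊛ h) m)
    ∎

⊛-∑ : ∀ p n (F : ℕ → ℤ → ℤ) → p ⊛ (λ x → ∑[ a < n ] F a x) ≗ λ m → ∑[ a < n ] (p ⊛ F a) m
⊛-∑ p zero    F m = ⊛-zeroʳ p m
⊛-∑ p (suc n) F m = trans (⊛-distribʳ-+ p (λ x → ∑[ a < n ] F a x) (F n) m) (cong (_+ (p ⊛ F n) m) (⊛-∑ p n F m))

⊛-++ : ∀ p r (g : ℤ → ℤ) → (p ++ r) ⊛ g ≗ λ m → (p ⊛ g) m + (r ⊛ g) m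
⊛-++ []            r g m = sym (ℤₚ.+-identityˡ _)
⊛-++ ((e , c) ∷ p) r g m = trans (cong (_+_ (c * g (m - e))) (⊛-++ p r g m)) (sym (ℤₚ.+-assoc (c * g (m - e)) _ _))

⊛-concatMap : ∀ (h : ℕ → LP) (f : ℕ → ℕ) n (g : ℤ → ℤ) →
  concatMap h (applyUpTo f n) ⊛ g ≗ λ m → ∑[ i < n ] (h (f i) ⊛ g) m
⊛-concatMap h f zero    g m = refl
⊛-concatMap h f (suc n) g m = begin
  (concatMap h (applyUpTo f (suc n)) ⊛ g) m
    ≡⟨ ⊛-++ (h (f 0)) (concatMap h (applyUpTo (f ∘ suc) n)) g m ⟩
  (h (f 0) ⊛ g) m + (concatMap h (applyUpTo (f ∘ suc) n) ⊛ g) m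
    ≡⟨ cong (_+_ ((h (f 0) ⊛ g) m)) (⊛-concatMap h (f ∘ suc) n g m) ⟩
  (h (f 0) ⊛ g) m + ∑[ i < n ] (h (f (suc i)) ⊛ g) m
    ≡⟨ ∑-head n (λ i → (h (f i) ⊛ g) m) ⟨
  ∑[ i < suc n ] (h (f i) ⊛ g) m
    ∎

⊛-scale-shift : ∀ p c e (g : ℤ → ℤ) → p ⊛ (λ x → c * g (x - e)) ≗ λ m → c * (p ⊛ g) (m - e)
⊛-scale-shift []             c e g m = sym (ℤₚ.*-zeroʳ c)
⊛-scale-shift ((e′ , c′) ∷ p) c e g m = begin
  c′ * (c * g (m - e′ - e)) + (p ⊛ (λ x → c * g (x - e))) m
    ≡⟨ cong₂ _+_ (cong (λ x → c′ * (c * g x)) (swap-shifts m e′ e)) (⊛-scale-shift p c e g m) ⟩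
  c′ * (c * g (m - e - e′)) + c * (p ⊛ g) (m - e)
    ≡⟨ pull-out c c′ (g (m - e - e′)) _ ⟩
  c * (c′ * g (m - e - e′) + (p ⊛ g) (m - e))
    ∎
  where
  swap-shifts : ∀ m e′ e → m - e′ - e ≡ m - e - e′
  swap-shifts = solve-∀
  pull-out : ∀ c c′ x y → c′ * (c * x) + c * y ≡ c * (c′ * x + y)
  pull-out = solve-∀

⊛-comm : ∀ p r (g : ℤ → ℤ) → p ⊛ (r ⊛ g) ≗ r ⊛ (p ⊛ g)
⊛-comm []            r g m = sym (⊛-zeroʳ r m)
⊛-comm ((e , c) ∷ p) r g m = begin
  c * (r ⊛ g) (m - e) + (p ⊛ (r ⊛ g)) m
    ≡⟨ cong₂ _+_ (sym (⊛-scale-shift r c e g m)) (⊛-comm p r g m) ⟩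
  (r ⊛ (λ x → c * g (x - e))) m + (r ⊛ (p ⊛ g)) m
    ≡⟨ ⊛-distribʳ-+ r (λ x → c * g (x - e)) (p ⊛ g) m ⟨
  (r ⊛ (((e , c) ∷ p) ⊛ g)) m
    ∎

mulLP-∷ : ∀ e c p r → mulLP ((e , c) ∷ p) r ≡ mulLP [ (e , c) ] r ++ mulLP p r
mulLP-∷ e c p r = cong (_++ mulLP p r) (sym (++-identityʳ _))

⊛-mulLP-monomial : ∀ e c r (g : ℤ → ℤ) → mulLP [ (e , c) ] r ⊛ g ≗ λ m → c * (r ⊛ g) (m - e)
⊛-mulLP-monomial e c []             g m = sym (ℤₚ.*-zeroʳ c)
⊛-mulLP-monomial e c ((e′ , c′) ∷ r) g m = begin
  c * c′ * g (m - (e + e′)) + (mulLP [ (e , c) ] r ⊛ g) m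
    ≡⟨ cong₂ _+_ (cong (λ x → c * c′ * g x) (shift-sum m e e′)) (⊛-mulLP-monomial e c r g m) ⟩
  c * c′ * g (m - e - e′) + c * (r ⊛ g) (m - e)
    ≡⟨ pull-out c c′ (g (m - e - e′)) _ ⟩
  c * (c′ * g (m - e - e′) + (r ⊛ g) (m - e))
    ∎
  where
  shift-sum : ∀ m e e′ → m - (e + e′) ≡ m - e - e′
  shift-sum = solve-∀
  pull-out : ∀ c c′ x y → c * c′ * x + c * y ≡ c * (c′ * x + y)
  pull-out = solve-∀

⊛-mulLP : ∀ p r (g : ℤ → ℤ) → mulLP p r ⊛ g ≗ p ⊛ (r ⊛ g)
⊛-mulLP []            r g m = refl
⊛-mulLP ((e , c) ∷ p) r g m = begin
  (mulLP ((e , c) ∷ p) r ⊛ g) m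
    ≡⟨ cong (λ s → (s ⊛ g) m) (mulLP-∷ e c p r) ⟩
  ((mulLP [ (e , c) ] r ++ mulLP p r) ⊛ g) m
    ≡⟨ ⊛-++ (mulLP [ (e , c) ] r) (mulLP p r) g m ⟩
  (mulLP [ (e , c) ] r ⊛ g) m + (mulLP p r ⊛ g) m
    ≡⟨ cong₂ _+_ (⊛-mulLP-monomial e c r g m) (⊛-mulLP p r g m) ⟩
  c * (r ⊛ g) (m - e) + (p ⊛ (r ⊛ g)) m
    ∎

⊛-monomial : ∀ u (g : ℤ → ℤ) → [ (u , 1ℤ) ] ⊛ g ≗ λ m → g (m - u)
⊛-monomial u g m = trans (ℤₚ.+-identityʳ _) (ℤₚ.*-identityˡ _)

⌊≟⌋-cong : ∀ {a b c d : ℤ} → (a ≡ b → c ≡ d) → (c ≡ d → a ≡ b) → ⌊ a ℤ.≟ b ⌋ ≡ ⌊ c ℤ.≟ d ⌋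
⌊≟⌋-cong {a} {b} {c} {d} ⇒ ⇐ with a ℤ.≟ b | c ℤ.≟ d
... | yes _   | yes _   = refl
... | no  _   | no  _   = refl
... | yes a≡b | no  c≢d = contradiction (⇒ a≡b) c≢d
... | no  a≢b | yes c≡d = contradiction (⇐ c≡d) a≢b

δ : ℤ → ℤ
δ = coeffLP [ (0ℤ , 1ℤ) ]

coeffLP-⊛δ : ∀ p → coeffLP p ≗ p ⊛ δ
coeffLP-⊛δ []            m = refl
coeffLP-⊛δ ((e , c) ∷ p) m
  rewrite ⌊≟⌋-cong {0ℤ} {m - e} {e} {m} (λ 0≡m-e → sym (ℤₚ.i-j≡0⇒i≡j m e (sym 0≡m-e))) (λ e≡m → sym (ℤₚ.i≡j⇒i-j≡0 (sym e≡m)))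
  with ⌊ e ℤ.≟ m ⌋
... | true  = cong₂ _+_ (sym (trans (cong (c *_) (ℤₚ.+-identityʳ 1ℤ)) (ℤₚ.*-identityʳ c))) (coeffLP-⊛δ p m)
... | false = trans (coeffLP-⊛δ p m) (sym (trans (cong (_+ (p ⊛ δ) m) (ℤₚ.*-zeroʳ c)) (ℤₚ.+-identityˡ _)))

coeffLP-++ : ∀ p r → coeffLP (p ++ r) ≗ λ m → coeffLP p m + coeffLP r m
coeffLP-++ p r m = begin
  coeffLP (p ++ r) m                 ≡⟨ coeffLP-⊛δ (p ++ r) m ⟩
  ((p ++ r) ⊛ δ) m                   ≡⟨ ⊛-++ p r δ m ⟩
  (p ⊛ δ) m + (r ⊛ δ) m              ≡⟨ cong₂ _+_ (coeffLP-⊛δ p m) (coeffLP-⊛δ r m) ⟨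
  coeffLP p m + coeffLP r m          ∎

⊛-coeffLP-comm : ∀ p r → p ⊛ coeffLP r ≗ r ⊛ coeffLP p
⊛-coeffLP-comm p r m = begin
  (p ⊛ coeffLP r) m      ≡⟨ ⊛-congʳ p (coeffLP-⊛δ r) m ⟩
  (p ⊛ (r ⊛ δ)) m        ≡⟨ ⊛-comm p r δ m ⟩
  (r ⊛ (p ⊛ δ)) m        ≡⟨ ⊛-congʳ r (coeffLP-⊛δ p) m ⟨
  (r ⊛ coeffLP p) m      ∎

⊛-congˡ : ∀ p q r → coeffLP p ≗ coeffLP q → p ⊛ coeffLP r ≗ q ⊛ coeffLP r
⊛-congˡ p q r p≗q m = begin
  (p ⊛ coeffLP r) m      ≡⟨ ⊛-coeffLP-comm p r m ⟩
  (r ⊛ coeffLP p) m      ≡⟨ ⊛-congʳ r p≗q m ⟩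
  (r ⊛ coeffLP q) m      ≡⟨ ⊛-coeffLP-comm q r m ⟨
  (q ⊛ coeffLP r) m      ∎

-- Power series in q up to equality of coefficients

infix 4 _≈[≤_]_ _≈_

record _≈[≤_]_ (F : PS) (k : ℕ) (G : PS) : Set where
  constructor agreeUpTo
  field coeff-agree : ∀ {N} → N ℕ.≤ k → coeffLP (F N) ≗ coeffLP (G N)
open _≈[≤_]_

_≈_ : PS → PS → Set
F ≈ G = ∀ k → F ≈[≤ k ] G

coeffwise : ∀ {F G} → (∀ N → coeffLP (F N) ≗ coeffLP (G N)) → F ≈ G
coeffwise F≗G k = agreeUpTo (λ {N} _ → F≗G N)

≈[≤]-refl : ∀ {k F} → F ≈[≤ k ] F
≈[≤]-refl = agreeUpTo (λ _ _ → refl)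

≈[≤]-sym : ∀ {k F G} → F ≈[≤ k ] G → G ≈[≤ k ] F
≈[≤]-sym F≈G = agreeUpTo (λ N≤k m → sym (coeff-agree F≈G N≤k m))

≈[≤]-trans : ∀ {k F G H} → F ≈[≤ k ] G → G ≈[≤ k ] H → F ≈[≤ k ] H
≈[≤]-trans F≈G G≈H = agreeUpTo (λ N≤k m → trans (coeff-agree F≈G N≤k m) (coeff-agree G≈H N≤k m))

⊛-⊗ : ∀ F G N (g : ℤ → ℤ) → (F ⊗ G) N ⊛ g ≗ λ m → conv N (λ i j → (F i ⊛ (G j ⊛ g)) m)
⊛-⊗ F G N g m = trans (⊛-concatMap (λ i → mulLP (F i) (G (N ∸ i))) (λ i → i) (suc N) g m)
                      (∑-cong (suc N) (λ i _ → ⊛-mulLP (F i) (G (N ∸ i)) g m))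

coeff-⊗ : ∀ F G N → coeffLP ((F ⊗ G) N) ≗ λ m → conv N (λ i j → (F i ⊛ coeffLP (G j)) m)
coeff-⊗ F G N m = begin
  coeffLP ((F ⊗ G) N) m                          ≡⟨ coeffLP-⊛δ ((F ⊗ G) N) m ⟩
  ((F ⊗ G) N ⊛ δ) m                              ≡⟨ ⊛-⊗ F G N δ m ⟩
  conv N (λ i j → (F i ⊛ (G j ⊛ δ)) m)           ≡⟨ conv-cong N (λ i j _ → ⊛-congʳ (F i) (coeffLP-⊛δ (G j)) m) ⟨
  conv N (λ i j → (F i ⊛ coeffLP (G j)) m)       ∎

⊗-cong≤ : ∀ {k F F′ G G′} → F ≈[≤ k ] F′ → G ≈[≤ k ] G′ → F ⊗ G ≈[≤ k ] F′ ⊗ G′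
⊗-cong≤ {k} {F} {F′} {G} {G′} F≈F′ G≈G′ = agreeUpTo λ {N} N≤k m → begin
  coeffLP ((F ⊗ G) N) m                        ≡⟨ coeff-⊗ F G N m ⟩
  conv N (λ i j → (F i ⊛ coeffLP (G j)) m)     ≡⟨ conv-cong N (λ i j i+j≡N → factors i j (subst (ℕ._≤ k) (sym i+j≡N) N≤k) m) ⟩
  conv N (λ i j → (F′ i ⊛ coeffLP (G′ j)) m)   ≡⟨ coeff-⊗ F′ G′ N m ⟨
  coeffLP ((F′ ⊗ G′) N) m                      ∎
  where
  factors : ∀ i j → i ℕ.+ j ℕ.≤ k → F i ⊛ coeffLP (G j) ≗ F′ i ⊛ coeffLP (G′ j)
  factors i j i+j≤k m = trans (⊛-congʳ (F i) (coeff-agree G≈G′ (ℕₚ.≤-trans (ℕₚ.m≤n+m j i) i+j≤k)) m)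
                              (⊛-congˡ (F i) (F′ i) (G′ j) (coeff-agree F≈F′ (ℕₚ.≤-trans (ℕₚ.m≤m+n i j) i+j≤k)) m)

⊗-cong : ∀ {F F′ G G′} → F ≈ F′ → G ≈ G′ → F ⊗ G ≈ F′ ⊗ G′
⊗-cong F≈F′ G≈G′ k = ⊗-cong≤ (F≈F′ k) (G≈G′ k)

⊗-comm : ∀ F G → F ⊗ G ≈ G ⊗ F
⊗-comm F G = coeffwise λ N m → begin
  coeffLP ((F ⊗ G) N) m                        ≡⟨ coeff-⊗ F G N m ⟩
  conv N (λ i j → (F i ⊛ coeffLP (G j)) m)     ≡⟨ conv-cong N (λ i j _ → ⊛-coeffLP-comm (F i) (G j) m) ⟩
  conv N (λ i j → (G j ⊛ coeffLP (F i)) m)     ≡⟨ conv-comm N (λ i j → (G j ⊛ coeffLP (F i)) m) ⟩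
  conv N (λ i j → (G i ⊛ coeffLP (F j)) m)     ≡⟨ coeff-⊗ G F N m ⟨
  coeffLP ((G ⊗ F) N) m                        ∎

⊗-assoc : ∀ F G H → (F ⊗ G) ⊗ H ≈ F ⊗ (G ⊗ H)
⊗-assoc F G H = coeffwise λ N m → begin
  coeffLP (((F ⊗ G) ⊗ H) N) m
    ≡⟨ coeff-⊗ (F ⊗ G) H N m ⟩
  conv N (λ i j → ((F ⊗ G) i ⊛ coeffLP (H j)) m)
    ≡⟨ conv-cong N (λ i j _ → ⊛-⊗ F G i (coeffLP (H j)) m) ⟩
  conv N (λ i j → conv i (λ k l → (F k ⊛ (G l ⊛ coeffLP (H j))) m))
    ≡⟨ conv-assoc N (λ k l j → (F k ⊛ (G l ⊛ coeffLP (H j))) m) ⟩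
  conv N (λ k p → conv p (λ l j → (F k ⊛ (G l ⊛ coeffLP (H j))) m))
    ≡⟨ conv-cong N (λ k p _ → ⊛-∑ (F k) (suc p) (λ l x → (G l ⊛ coeffLP (H (p ∸ l))) x) m) ⟨
  conv N (λ k p → (F k ⊛ (λ x → conv p (λ l j → (G l ⊛ coeffLP (H j)) x))) m)
    ≡⟨ conv-cong N (λ k p _ → ⊛-congʳ (F k) (coeff-⊗ G H p) m) ⟨
  conv N (λ k p → (F k ⊛ coeffLP ((G ⊗ H) p)) m)
    ≡⟨ coeff-⊗ F (G ⊗ H) N m ⟨
  coeffLP ((F ⊗ (G ⊗ H)) N) m
    ∎

⊗-identityʳ : ∀ F → F ⊗ onePS ≈ F
⊗-identityʳ F = coeffwise λ N m → begin
  coeffLP ((F ⊗ onePS) N) m                          ≡⟨ coeff-⊗ F onePS N m ⟩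
  conv N (λ i j → (F i ⊛ coeffLP (onePS j)) m)       ≡⟨ conv-comm N (λ i j → (F i ⊛ coeffLP (onePS j)) m) ⟩
  conv N (λ i j → (F j ⊛ coeffLP (onePS i)) m)       ≡⟨ conv-unitˡ N (λ i j → (F j ⊛ coeffLP (onePS i)) m) (λ i j → ⊛-zeroʳ (F j) m) ⟩
  (F N ⊛ δ) m                                        ≡⟨ coeffLP-⊛δ (F N) m ⟨
  coeffLP (F N) m                                    ∎

⊗-commutativeSemigroup : CommutativeSemigroup 0ℓ 0ℓ
⊗-commutativeSemigroup = record
  { Carrier = PS
  ; _≈_ = _≈_
  ; _∙_ = _⊗_
  ; isCommutativeSemigroup = record
    { isSemigroup = record
      { isMagma = record
        { isEquivalence = record
          { refl  = λ k → ≈[≤]-refl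
          ; sym   = λ F≈G k → ≈[≤]-sym (F≈G k)
          ; trans = λ F≈G G≈H k → ≈[≤]-trans (F≈G k) (G≈H k)
          }
        ; ∙-cong = ⊗-cong
        }
      ; assoc = ⊗-assoc
      }
    ; comm = ⊗-comm
    }
  }

open CommSemigroupProperties ⊗-commutativeSemigroup using () renaming (interchange to ⊗-interchange)

-- The class 𝒰²_z

-- The two parity conditions of InU2z are merged into c (n + 2) ≤ c n for n ≥ 0.
record U² (c : ℤ → ℤ) : Set where
  field
    nonneg    : ∀ i → 0ℤ ≤ c i
    symmetric : ∀ i → c (- i) ≡ c i
    antitone₂ : ∀ n → c (+ (n ℕ.+ 2)) ≤ c (+ n)
open U²

U²⇒InU2z : ∀ {c} → U² c → InU2z c
U²⇒InU2z {c} c∈U² = nonneg c∈U² , symmetric c∈U² , λ r ℓ _ →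
  subst (λ n → c (+ n) ≤ c (+ (r ℕ.+ 2 ℕ.* ℓ))) (two-steps r ℓ) (antitone₂ c∈U² (r ℕ.+ 2 ℕ.* ℓ))
  where
  two-steps : ∀ r ℓ → r ℕ.+ 2 ℕ.* ℓ ℕ.+ 2 ≡ r ℕ.+ 2 ℕ.* suc ℓ
  two-steps r ℓ = trans (ℕₚ.+-assoc r (2 ℕ.* ℓ) 2)
                        (cong (r ℕ.+_) (trans (ℕₚ.+-comm (2 ℕ.* ℓ) 2) (sym (ℕₚ.*-suc 2 ℓ))))

U²-cong : ∀ {c d} → c ≗ d → U² c → U² d
U²-cong c≗d c∈U² = record
  { nonneg    = λ i → subst (0ℤ ≤_) (c≗d i) (nonneg c∈U² i)
  ; symmetric = λ i → trans (sym (c≗d (- i))) (trans (symmetric c∈U² i) (c≗d i))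
  ; antitone₂ = λ n → subst₂ _≤_ (c≗d _) (c≗d _) (antitone₂ c∈U² n)
  }

U²-zero : U² (λ _ → 0ℤ)
U²-zero = record { nonneg = λ _ → ℤₚ.≤-refl ; symmetric = λ _ → refl ; antitone₂ = λ _ → ℤₚ.≤-refl }

U²-+ : ∀ {c d} → U² c → U² d → U² (λ x → c x + d x)
U²-+ c∈U² d∈U² = record
  { nonneg    = λ i → ℤₚ.+-mono-≤ (nonneg c∈U² i) (nonneg d∈U² i)
  ; symmetric = λ i → cong₂ _+_ (symmetric c∈U² i) (symmetric d∈U² i)
  ; antitone₂ = λ n → ℤₚ.+-mono-≤ (antitone₂ c∈U² n) (antitone₂ d∈U² n)
  }

U²-∑ : ∀ n {F : ℕ → ℤ → ℤ} → (∀ a → U² (F a)) → U² (λ x → ∑[ a < n ] F a x)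
U²-∑ zero    F∈U² = U²-zero
U²-∑ (suc n) F∈U² = U²-+ (U²-∑ n F∈U²) (F∈U² n)

U²-conv : ∀ N {h : ℕ → ℕ → ℤ → ℤ} → (∀ i j → U² (h i j)) → U² (λ x → conv N (λ i j → h i j x))
U²-conv N h∈U² = U²-∑ (suc N) (λ i → h∈U² i (N ∸ i))

U²-if : ∀ b {c} → U² c → U² (λ x → if b then c x else 0ℤ)
U²-if true  c∈U² = c∈U²
U²-if false c∈U² = U²-zero

U²-δ : U² δ
U²-δ = record { nonneg = δ-nonneg ; symmetric = δ-symmetric ; antitone₂ = δ-antitone₂ }
  where
  δ-nonneg : ∀ i → 0ℤ ≤ δ i
  δ-nonneg i with 0ℤ ℤ.≟ i
  ... | yes _ = ℤ.+≤+ ℕ.z≤n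
  ... | no  _ = ℤₚ.≤-refl
  δ-symmetric : ∀ i → δ (- i) ≡ δ i
  δ-symmetric i rewrite ⌊≟⌋-cong {0ℤ} { - i} {0ℤ} {i} (λ 0≡-i → trans (cong (λ x → - x) 0≡-i) (ℤₚ.neg-involutive i)) (cong (λ x → - x)) = refl
  δ-antitone₂ : ∀ n → δ (+ (n ℕ.+ 2)) ≤ δ (+ n)
  δ-antitone₂ n with 0ℤ ℤ.≟ + (n ℕ.+ 2)
  ... | yes 0≡n+2 = contradiction (sym (ℤₚ.+-injective 0≡n+2)) (ℕₚ.m+1+n≢0 n)
  ... | no  _     = δ-nonneg (+ n)

-- (z^t + z^(t-2) + ⋯ + z^(-t)) · G, with g the coefficients of G
mulSym : ℕ → (ℤ → ℤ) → ℤ → ℤ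
mulSym t g m = conv t (λ a b → g (m - + a + + b))

mulSym-zero : ∀ (g : ℤ → ℤ) m → mulSym 0 g m ≡ g m
mulSym-zero g m = trans (ℤₚ.+-identityˡ _) (cong g (trans (ℤₚ.+-identityʳ _) (ℤₚ.+-identityʳ m)))

mulSym-suc : ∀ t (g : ℤ → ℤ) m → mulSym (suc t) g m ≡ g (m + + suc t) + mulSym t g (m - 1ℤ)
mulSym-suc t g m = trans (conv-head t (λ a b → g (m - + a + + b)))
  (cong₂ _+_ (cong (λ x → g (x + + suc t)) (ℤₚ.+-identityʳ m))
             (conv-cong t (λ a b _ → cong g (shift m (+ a) (+ b)))))
  where
  shift : ∀ m a b → m - (1ℤ + a) + b ≡ m - 1ℤ - a + b
  shift = solve-∀

mulSym-symmetric : ∀ {g} → U² g → ∀ t m → mulSym t g (- m) ≡ mulSym t g m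
mulSym-symmetric {g} g∈U² t m = begin
  conv t (λ a b → g (- m - + a + + b))    ≡⟨ conv-cong t (λ a b _ → trans (cong g (reflect m (+ a) (+ b))) (symmetric g∈U² _)) ⟩
  conv t (λ a b → g (m - + b + + a))      ≡⟨ conv-comm t (λ a b → g (m - + a + + b)) ⟨
  conv t (λ a b → g (m - + a + + b))      ∎
  where
  reflect : ∀ m a b → - m - a + b ≡ - (m - b + a)
  reflect = solve-∀

mulSym-antitone₂ : ∀ {g} → U² g → ∀ t n → mulSym t g (+ (n ℕ.+ 2)) ≤ mulSym t g (+ n)
mulSym-antitone₂ {g} g∈U² zero    n =
  subst₂ _≤_ (sym (mulSym-zero g (+ (n ℕ.+ 2)))) (sym (mulSym-zero g (+ n))) (antitone₂ g∈U² n)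
mulSym-antitone₂ {g} g∈U² (suc t) n = subst₂ _≤_ (sym (mulSym-suc t g (+ (n ℕ.+ 2)))) (sym (mulSym-suc t g (+ n)))
  (ℤₚ.+-mono-≤ outer (inner n))
  where
  outer : g (+ (n ℕ.+ 2) + + suc t) ≤ g (+ n + + suc t)
  outer = subst₂ (λ x y → g x ≤ g y)
    (trans (cong +_ (trans (ℕₚ.+-assoc n (suc t) 2) (trans (cong (n ℕ.+_) (ℕₚ.+-comm (suc t) 2)) (sym (ℕₚ.+-assoc n 2 (suc t))))))
           (ℤₚ.pos-+ (n ℕ.+ 2) (suc t)))
    (ℤₚ.pos-+ n (suc t))
    (antitone₂ g∈U² (n ℕ.+ suc t))
  inner : ∀ n → mulSym t g (+ (n ℕ.+ 2) - 1ℤ) ≤ mulSym t g (+ n - 1ℤ)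
  inner zero    = ℤₚ.≤-reflexive (sym (mulSym-symmetric g∈U² t 1ℤ))
  inner (suc n) = mulSym-antitone₂ g∈U² t n

U²-mulSym : ∀ t {g} → U² g → U² (mulSym t g)
U²-mulSym t g∈U² = record
  { nonneg    = λ m → ∑-nonneg (suc t) (λ i → nonneg g∈U² _)
  ; symmetric = mulSym-symmetric g∈U² t
  ; antitone₂ = mulSym-antitone₂ g∈U² t
  }

-- Products of paired factors

geom-⊛ : ∀ e j i (g : ℤ → ℤ) → geom e j i ⊛ g ≗ λ x → dilate j (λ a → g (x - e * + a)) i
geom-⊛ e j i g x with i % suc j ≡ᵇ 0
... | true  = ⊛-monomial (e * + (i / suc j)) g x
... | false = refl

Q : ℕ → PS
Q j = geom (+ 1) j ⊗ geom (- (+ 1)) j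

-- Q j = ∑_t (z^t + z^(t-2) + ⋯ + z^(-t)) q^((j+1) t)
⊛-Q : ∀ j p k → p ⊛ coeffLP (Q j k) ≗ λ m → dilate j (λ t → mulSym t (coeffLP p) m) k
⊛-Q j p k m = begin
  (p ⊛ coeffLP (Q j k)) m
    ≡⟨ ⊛-congʳ p (coeff-⊗ (geom (+ 1) j) (geom (- (+ 1)) j) k) m ⟩
  (p ⊛ (λ x → conv k (λ i l → (geom (+ 1) j i ⊛ coeffLP (geom (- (+ 1)) j l)) x))) m
    ≡⟨ ⊛-∑ p (suc k) (λ i → geom (+ 1) j i ⊛ coeffLP (geom (- (+ 1)) j (k ∸ i))) m ⟩
  conv k (λ i l → (p ⊛ (geom (+ 1) j i ⊛ coeffLP (geom (- (+ 1)) j l))) m)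
    ≡⟨ conv-cong k (λ i l _ → dilated-term i l) ⟩
  conv k (λ i l → dilate j (λ a → dilate j (X a) l) i)
    ≡⟨ conv-dilate j k X ⟩
  dilate j (λ t → conv t X) k
    ≡⟨ dilate-cong j (λ t → conv-cong t (λ a b _ → cong (coeffLP p) (exponent m (+ a) (+ b)))) k ⟩
  dilate j (λ t → mulSym t (coeffLP p) m) k
    ∎
  where
  X : ℕ → ℕ → ℤ
  X a b = coeffLP p (m - + 1 * + a - - (+ 1) * + b)
  exponent : ∀ m a b → m - 1ℤ * a - - 1ℤ * b ≡ m - a + b
  exponent = solve-∀
  dilated-term : ∀ i l → (p ⊛ (geom (+ 1) j i ⊛ coeffLP (geom (- (+ 1)) j l))) m ≡ dilate j (λ a → dilate j (X a) l) i
  dilated-term i l = begin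
    (p ⊛ (geom (+ 1) j i ⊛ coeffLP (geom (- (+ 1)) j l))) m
      ≡⟨ ⊛-comm p (geom (+ 1) j i) (coeffLP (geom (- (+ 1)) j l)) m ⟩
    (geom (+ 1) j i ⊛ (p ⊛ coeffLP (geom (- (+ 1)) j l))) m
      ≡⟨ ⊛-congʳ (geom (+ 1) j i) (⊛-coeffLP-comm p (geom (- (+ 1)) j l)) m ⟩
    (geom (+ 1) j i ⊛ (geom (- (+ 1)) j l ⊛ coeffLP p)) m
      ≡⟨ geom-⊛ (+ 1) j i (geom (- (+ 1)) j l ⊛ coeffLP p) m ⟩
    dilate j (λ a → (geom (- (+ 1)) j l ⊛ coeffLP p) (m - + 1 * + a)) i
      ≡⟨ dilate-cong j (λ a → geom-⊛ (- (+ 1)) j l (coeffLP p) (m - + 1 * + a)) i ⟩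
    dilate j (λ a → dilate j (X a) l) i
      ∎

U²ₛ : PS → Set
U²ₛ F = ∀ N → U² (coeffLP (F N))

U²ₛ-cong : ∀ {F G} → F ≈ G → U²ₛ F → U²ₛ G
U²ₛ-cong F≈G F∈U² N = U²-cong (coeff-agree (F≈G N) ℕₚ.≤-refl) (F∈U² N)

U²ₛ-one : U²ₛ onePS
U²ₛ-one zero    = U²-δ
U²ₛ-one (suc N) = U²-zero

U²ₛ-⊗-Q : ∀ j P → U²ₛ P → U²ₛ (P ⊗ Q j)
U²ₛ-⊗-Q j P P∈U² N =
  U²-cong (λ m → sym (trans (coeff-⊗ P (Q j) N m) (conv-cong N (λ i k _ → ⊛-Q j (P i) k m))))
          (U²-conv N (λ i k → U²-if (k % suc j ≡ᵇ 0) (U²-mulSym (k / suc j) (P∈U² i))))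

U²ₛ-paired-products : ∀ (f : ℕ → ℕ) L →
  U²ₛ (prodPS (map (geom (+ 1) ∘ f) L) ⊗ prodPS (map (geom (- (+ 1)) ∘ f) L))
U²ₛ-paired-products f []      = U²ₛ-cong (λ k → ≈[≤]-sym (⊗-identityʳ onePS k)) U²ₛ-one
U²ₛ-paired-products f (j ∷ L) = U²ₛ-cong regroup (U²ₛ-⊗-Q (f j) (A ⊗ B) (U²ₛ-paired-products f L))
  where
  A B : PS
  A = prodPS (map (geom (+ 1) ∘ f) L)
  B = prodPS (map (geom (- (+ 1)) ∘ f) L)
  regroup : (A ⊗ B) ⊗ Q (f j) ≈ (geom (+ 1) (f j) ⊗ A) ⊗ (geom (- (+ 1)) (f j) ⊗ B)
  regroup k = ≈[≤]-trans (⊗-comm (A ⊗ B) (Q (f j)) k) (≈[≤]-sym (⊗-interchange (geom (+ 1) (f j)) A (geom (- (+ 1)) (f j)) B k))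

U²ₛ-invPoch-pair : ∀ b n → U²ₛ (invPoch (+ 1) b n ⊗ invPoch (- (+ 1)) b n)
U²ₛ-invPoch-pair b n = U²ₛ-paired-products (λ j → b ℕ.+ 2 ℕ.* j) (upTo n)

-- Truncating the infinite products

foldr-cong≤ : ∀ L {k Y Y′} → Y ≈[≤ k ] Y′ → foldr _⊗_ Y L ≈[≤ k ] foldr _⊗_ Y′ L
foldr-cong≤ []      Y≈Y′ = Y≈Y′
foldr-cong≤ (F ∷ L) Y≈Y′ = ⊗-cong≤ (≈[≤]-refl {F = F}) (foldr-cong≤ L Y≈Y′)

geom-≈[≤]-onePS : ∀ e j {k} → k ℕ.≤ j → geom e j ≈[≤ k ] onePS
geom-≈[≤]-onePS e j k≤j = agreeUpTo λ {N} N≤k → below N (ℕₚ.≤-trans N≤k k≤j)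
  where
  below : ∀ N → N ℕ.≤ j → coeffLP (geom e j N) ≗ coeffLP (onePS N)
  below N N≤j m rewrite m≤n⇒m%n≡m N≤j with N
  ... | zero  rewrite ℤₚ.*-zeroʳ e = refl
  ... | suc _ = refl

invPoch-suc : ∀ e b n {k} → k ℕ.≤ b ℕ.+ 2 ℕ.* n → invPoch e b (suc n) ≈[≤ k ] invPoch e b n
invPoch-suc e b n {k} k≤ = subst (_≈[≤ k ] invPoch e b n) (sym last-factor)
  (foldr-cong≤ (map h (upTo n)) (≈[≤]-trans (⊗-identityʳ (h n) k) (geom-≈[≤]-onePS e (b ℕ.+ 2 ℕ.* n) k≤)))
  where
  h : ℕ → PS
  h j = geom e (b ℕ.+ 2 ℕ.* j)
  last-factor : invPoch e b (suc n) ≡ foldr _⊗_ (h n ⊗ onePS) (map h (upTo n))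
  last-factor = begin
    prodPS (map h (upTo (suc n)))          ≡⟨ cong (prodPS ∘ map h) (upTo-∷ʳ n) ⟨
    prodPS (map h (upTo n ++ [ n ]))       ≡⟨ cong prodPS (map-++ h (upTo n) [ n ]) ⟩
    prodPS (map h (upTo n) ++ [ h n ])     ≡⟨ foldr-++ _⊗_ onePS (map h (upTo n)) [ h n ] ⟩
    foldr _⊗_ (h n ⊗ onePS) (map h (upTo n)) ∎

invPoch-stable : ∀ e b k d → invPoch e b (d ℕ.+ suc k) ≈[≤ k ] invPoch e b (suc k)
invPoch-stable e b k zero    = ≈[≤]-refl
invPoch-stable e b k (suc d) = ≈[≤]-trans (invPoch-suc e b (d ℕ.+ suc k) k≤) (invPoch-stable e b k d)
  where
  k≤ : k ℕ.≤ b ℕ.+ 2 ℕ.* (d ℕ.+ suc k)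
  k≤ = ℕₚ.≤-trans (ℕₚ.≤-trans (ℕₚ.n≤1+n k) (ℕₚ.m≤n+m (suc k) d))
                  (ℕₚ.≤-trans (ℕₚ.m≤n*m (d ℕ.+ suc k) 2) (ℕₚ.m≤n+m _ b))

invPochInf-≈[≤] : ∀ e b l → invPochInf e b ≈[≤ l ] invPoch e b (suc l)
invPochInf-≈[≤] e b l = agreeUpTo λ {N} N≤l m → sym (trans
  (cong (λ n → coeffLP (invPoch e b n N) m) (sym (trans (ℕₚ.+-suc (l ∸ N) N) (cong suc (ℕₚ.m∸n+n≡m N≤l)))))
  (coeff-agree (invPoch-stable e b N (l ∸ N)) ℕₚ.≤-refl m))

U²ₛ-invPochInf-pair : ∀ b → U²ₛ (invPochInf (+ 1) b ⊗ invPochInf (- (+ 1)) b)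
U²ₛ-invPochInf-pair b l =
  U²-cong (λ m → sym (coeff-agree (⊗-cong≤ (invPochInf-≈[≤] (+ 1) b l) (invPochInf-≈[≤] (- (+ 1)) b l)) ℕₚ.≤-refl m))
          (U²ₛ-invPoch-pair b (suc l) l)

qpow-⊛ : ∀ c i (g : ℤ → ℤ) → qpow c i ⊛ g ≗ λ m → if c ≡ᵇ i then g m else 0ℤ
qpow-⊛ c i g m with c ≡ᵇ i
... | true  = trans (⊛-monomial 0ℤ g m) (cong g (ℤₚ.+-identityʳ m))
... | false = refl

U²ₛ-qpow-⊗ : ∀ c Y → U²ₛ Y → U²ₛ (qpow c ⊗ Y)
U²ₛ-qpow-⊗ c Y Y∈U² N =
  U²-cong (λ m → sym (trans (coeff-⊗ (qpow c) Y N m) (conv-cong N (λ i l _ → qpow-⊛ c i (coeffLP (Y l)) m))))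
          (U²-conv N (λ i l → U²-if (c ≡ᵇ i) (Y∈U² l)))

U²-sumPS : ∀ (T : ℕ → PS) L N → (∀ k → U² (coeffLP (T k N))) → U² (coeffLP (sumPS (map T L) N))
U²-sumPS T []      N T∈U² = U²-zero
U²-sumPS T (k ∷ L) N T∈U² = U²-cong (λ m → sym (coeffLP-++ (T k N) (sumPS (map T L) N) m))
                                    (U²-+ (T∈U² k) (U²-sumPS T L N T∈U²))

U²-VO : ∀ n → U² (coeffLP (VOser n))
U²-VO n = U²-sumPS (λ k → qpow (2 ℕ.* k ℕ.+ 1) ⊗ Y k) (upTo (suc n)) n
  (λ k → U²ₛ-qpow-⊗ (2 ℕ.* k ℕ.+ 1) (Y k) (U²ₛ-invPochInf-pair (2 ℕ.* k ℕ.+ 2)) n)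
  where
  Y : ℕ → PS
  Y k = invPochInf (+ 1) (2 ℕ.* k ℕ.+ 2) ⊗ invPochInf (- (+ 1)) (2 ℕ.* k ℕ.+ 2)

U²-XO : ∀ n → U² (coeffLP (XOser n))
U²-XO n = U²-sumPS (λ k → qpow (2 ℕ.* k ℕ.+ 1) ⊗ Y k) (upTo (suc n)) n
  (λ k → U²ₛ-qpow-⊗ (2 ℕ.* k ℕ.+ 1) (Y k) (U²ₛ-invPoch-pair 0 k) n)
  where
  Y : ℕ → PS
  Y k = invPoch (+ 1) 0 k ⊗ invPoch (- (+ 1)) 0 k

theorem4p8 : InU2zq VOser × InU2zq XOser
             × (∀ (m n : ℕ) → VO (+ (m Data.Nat.+ 2)) n ≤ VO (+ m) n)
             × (∀ (m n : ℕ) → XO (+ (m Data.Nat.+ 2)) n ≤ XO (+ m) n)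
theorem4p8 = (λ n → U²⇒InU2z (U²-VO n)) , (λ n → U²⇒InU2z (U²-XO n))
           , (λ m n → antitone₂ (U²-VO n) m) , (λ m n → antitone₂ (U²-XO n) m)
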